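{- Let $G=(V,E)$ be a directed simple $st$-graph. Then $G$ is weak if and only if there exist a minimal vertex separator $T$ of $G$, vertices $a,b\in T$ (possibly $a=b$), and a directed walk from $a$ to $b$ consisting of at least one edge.
   Context: A directed simple $st$-graph is a finite directed graph $G=(V,E)$ without self-loops or parallel edges, with a distinguished source $s$ (no incoming edges) and a distinguished sink $t\neq s$ (no outgoing edges), such that every vertex lies on some directed walk from $s$ to $t$. An $st$-path is a (possibly cyclic) directed walk from $s$ to $t$; $P(G)$ denotes the set of all $st$-paths. For a walk $p$ and a vertex $v$, $m_v(p)$ is the number of occurrences of $v$ in $p$ (0 if $v\notin p$). A depletable channel on $G$ is a charge function $\eta:V\to\mathbb{N}\cup\{\infty\}$ with $\eta(s)=\eta(t)=\infty$ and $\eta(v)\in\mathbb{N}$ otherwise. A flow for $\eta$ is a function $\phi:P(G)\to\mathbb{N}$ with $\phi(v):=\sum_{p\in P(G)} m_v(p)\phi(p)\le \eta(v)$ for every $v\in V$; its value is $\sum_p\phi(p)$. $\max_\eta$ is the maximum value of a flow for $\eta$; $\eta$ is dead if $\max_\eta=0$. The residual of $\eta$ after $\phi$ is $\eta'(v)=\eta(v)-\phi(v)$. A flow $\phi$ inhibits $\eta$ if the residual of $\eta$ after $\phi$ is dead, and $\min_\eta$ is the smallest value of an inhibiting flow for $\eta$. The graph $G$ is weak if $\min_\eta\neq\max_\eta$ for some channel $\eta$ on $G$. A minimal vertex separator (mvs) is a set $T\subseteq V$ such that every $st$-path contains a vertex of $T$, and which is minimal with respect to inclusion with this property (so $\{s\}$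 and $\{t\}$ are mvs's). -}

module Defs where

open import Data.Nat using (ℕ; zero; suc; _+_; _∸_; _≤_; _<_)
open import Data.Bool using (Bool; true; false; T; if_then_else_)
open import Data.Fin using (Fin; _≟_)
open import Data.Fin.Subset using (Subset; _∈_; _⊆_)
open import Data.List using (List; []; _∷_; map; length)
open import Data.Nat.ListAction using (sum)
open import Data.Maybe using (Maybe; just; nothing)
open import Data.Product using (Σ; ∃; _×_; _,_)
open import Relation.Nullary using (¬_; Dec; yes; no)
open import Relation.Nullary.Decidable using (⌊_⌋)
open import Relation.Binary.PropositionalEquality using (_≡_; _≢_)
open import Function.Bundles using (_⇔_)

-- Since edges are given by a Bool-valued relation (T (E u v) has at most one
-- proof), a walk is determined by its vertex sequence.
data Walk {n : ℕ} (E : Fin n → Fin n → Bool) : Fin n → Fin n → Set where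
  [_]  : (v : Fin n) → Walk E v v
  step : ∀ {w} (u : Fin n) {v : Fin n} → T (E u v) → Walk E v w → Walk E u w

len : ∀ {n E} {a b : Fin n} → Walk E a b → ℕ
len [ _ ]        = 0
len (step _ _ p) = suc (len p)

occ : ∀ {n E} {a b : Fin n} → Fin n → Walk E a b → ℕ
occ x [ v ]        = if ⌊ x ≟ v ⌋ then 1 else 0
occ x (step u _ p) = (if ⌊ x ≟ u ⌋ then 1 else 0) + occ x p

record StGraph (n : ℕ) : Set where
  field
    E       : Fin n → Fin n → Bool
    s t     : Fin n
    noLoop  : ∀ v → E v v ≡ false
    s≢t     : s ≢ t
    noIn    : ∀ u → E u s ≡ false
    noOut   : ∀ v → E t v ≡ false
    covered : ∀ v → Walk E s v × Walk E v t

module _ {n : ℕ} (G : StGraph n) where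
  open StGraph G

  StPath : Set
  StPath = Walk E s t

  -- Charge function: η(v) ∈ ℕ for v ∉ {s,t}; η(s) = η(t) = ∞ is modelled by
  -- ignoring the values of η at s and t.
  Charge : Set
  Charge = Fin n → ℕ

  Internal : Fin n → Set
  Internal v = v ≢ s × v ≢ t

  -- A (necessarily finitely supported) function φ : P(G) → ℕ is represented
  -- as a finite multiset of st-paths, i.e. a list in which p occurs φ(p) times.
  Flow : Set
  Flow = List StPath

  load : Flow → Fin n → ℕ
  load φ v = sum (map (occ v) φ)

  value : Flow → ℕ
  value φ = length φ

  IsFlow : Charge → Flow → Set
  IsFlow η φ = ∀ v → Internal v → load φ v ≤ η v

  -- max_η, with nothing standing for ∞
  IsMax : Charge → Maybe ℕ → Set
  IsMax η (just m) = (Σ Flow λ φ → IsFlow η φ × value φ ≡ m)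
                   × (∀ φ → IsFlow η φ → value φ ≤ m)
  IsMax η nothing  = ∀ k → Σ Flow λ φ → IsFlow η φ × k ≤ value φ

  Dead : Charge → Set
  Dead η = IsMax η (just 0)

  residual : Charge → Flow → Charge
  residual η φ v = η v ∸ load φ v

  Inhibits : Charge → Flow → Set
  Inhibits η φ = IsFlow η φ × Dead (residual η φ)

  -- min_η, with nothing standing for ∞ (no inhibiting flow exists)
  IsMin : Charge → Maybe ℕ → Set
  IsMin η (just m) = (Σ Flow λ φ → Inhibits η φ × value φ ≡ m)
                   × (∀ φ → Inhibits η φ → m ≤ value φ)
  IsMin η nothing  = ¬ (Σ Flow λ φ → Inhibits η φ)

  Weak : Set
  Weak = Σ Charge λ η → Σ (Maybe ℕ) λ x → Σ (Maybe ℕ) λ y →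
           IsMin η x × IsMax η y × x ≢ y

  Separator : Subset n → Set
  Separator X = ∀ (p : StPath) → Σ (Fin n) λ v → v ∈ X × 1 ≤ occ v p

  IsMVS : Subset n → Set
  IsMVS X = Separator X × (∀ Y → Y ⊆ X → Separator Y → X ⊆ Y)

module Submission where

-- (⇒) If min_η ≠ max_η, some inhibiting flow φ has smaller value than some
-- flow ψ.  The internal vertices saturated by φ separate s from t (an st-path
-- avoiding them would be a residual flow), so they contain an mvs T.  Every
-- path of ψ visits T, and on T the load of ψ is at most that of φ; counting
-- visits to T path by path and vertex by vertex shows that some path of φ
-- visits T twice, and the stretch between two consecutive visits is the walk.
-- (⇐) Cut the walk at its first return c to T and splice it with st-paths
-- through a and through c that meet T only there: the resulting st-path q
-- meets T exactly in a and c, and the charge δ_a + δ_c on T has min 1, max 2.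

open import Defs
open import Data.Bool using (Bool; if_then_else_) renaming (T to IsTrue)
open import Data.Empty using (⊥; ⊥-elim)
open import Data.Fin using (Fin; zero; suc; _≟_)
open import Data.Fin.Properties using (any?)
open import Data.Fin.Subset using (Subset; _∈_; _∉_; _⊆_; _-_; ∣_∣)
open import Data.Fin.Subset.Properties using (_∈?_; x∈p∧x≢y⇒x∈p-y; p─q⊆p; x∈p⇒∣p-x∣<∣p∣)
open import Data.Nat.Induction using (<-wellFounded)
open import Data.List using (List; []; _∷_; map; length; _++_)
open import Data.List.Properties using (map-++; length-++)
open import Data.Maybe using (just; nothing)
open import Data.Nat using (ℕ; zero; suc; _+_; _*_; _∸_; _≤_; _<_; z≤n; s≤s)
open import Data.Nat.ListAction using (sum)
open import Data.Nat.ListAction.Properties using (sum-++)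
open import Data.Nat.Properties hiding (_≟_)
open import Data.Nat.Properties using () renaming (_≟_ to _≟ℕ_)
open import Data.Product using (Σ; ∃; _×_; _,_; proj₁; proj₂)
open import Data.Sum using (_⊎_; inj₁; inj₂)
open import Data.Vec using (lookup; tabulate; here; there) renaming (_∷_ to _∷ᵥ_)
open import Data.Vec.Properties using ([]=⇒lookup; lookup⇒[]=; lookup∘tabulate)
open import Function.Bundles using (_⇔_; mk⇔)
open import Induction.WellFounded using (Acc; acc)
open import Relation.Binary.PropositionalEquality
open import Relation.Nullary using (¬?; Dec; yes; no; does)
open import Relation.Nullary.Decidable using (⌊_⌋; map′; _×-dec_; T?)

import Algebra.Properties.CommutativeMonoid.Sum +-0-commutativeMonoid as FinSum
open FinSum using (sum-syntax; ∑-distrib-+; sum-cong-≗; sum-replicate-zero)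

δ : ∀ {n} → Fin n → Fin n → ℕ
δ x u = if ⌊ x ≟ u ⌋ then 1 else 0

δ-refl : ∀ {n} (x : Fin n) → δ x x ≡ 1
δ-refl x with x ≟ x
... | yes _  = refl
... | no x≢x = ⊥-elim (x≢x refl)

δ-≢ : ∀ {n} {x u : Fin n} → x ≢ u → δ x u ≡ 0
δ-≢ {x = x} {u} x≢u with x ≟ u
... | yes x≡u = ⊥-elim (x≢u x≡u)
... | no _    = refl

δ-≤1 : ∀ {n} (x u : Fin n) → δ x u ≤ 1
δ-≤1 x u with x ≟ u
... | yes _ = s≤s z≤n
... | no _  = z≤n

δ-pos : ∀ {n} {x u : Fin n} → 1 ≤ δ x u → x ≡ u
δ-pos {x = x} {u} 1≤δ with x ≟ u
... | yes x≡u = x≡u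
δ-pos {x = x} {u} () | no _

δ-suc : ∀ {n} (x u : Fin n) → δ (suc x) (suc u) ≡ δ x u
δ-suc x u with x ≟ u
... | yes _ = refl
... | no _  = refl

∑-mono : ∀ {n} (f g : Fin n → ℕ) → (∀ v → f v ≤ g v) → ∑[ v < n ] f v ≤ ∑[ v < n ] g v
∑-mono {zero}  f g f≤g = z≤n
∑-mono {suc n} f g f≤g = +-mono-≤ (f≤g zero) (∑-mono (λ v → f (suc v)) (λ v → g (suc v)) (λ v → f≤g (suc v)))

∑-zero : ∀ n (h : Fin n → ℕ) → ∑[ v < n ] (h v * 0) ≡ 0
∑-zero n h = trans (sum-cong-≗ (λ v → *-zeroʳ (h v))) (sum-replicate-zero n)

∑-sift : ∀ {n} (g : Fin n → ℕ) (u : Fin n) → ∑[ v < n ] (g v * δ v u) ≡ g u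
∑-sift {suc n} g zero = begin
  g zero * 1 + ∑[ v < n ] (g (suc v) * 0)  ≡⟨ cong₂ _+_ (*-identityʳ (g zero)) (∑-zero n (λ v → g (suc v))) ⟩
  g zero + 0                              ≡⟨ +-identityʳ (g zero) ⟩
  g zero                                  ∎
  where open ≡-Reasoning
∑-sift {suc n} g (suc u) = begin
  g zero * 0 + ∑[ v < n ] (g (suc v) * δ (suc v) (suc u))
    ≡⟨ cong₂ _+_ (*-zeroʳ (g zero)) (sum-cong-≗ (λ v → cong (g (suc v) *_) (δ-suc v u))) ⟩
  ∑[ v < n ] (g (suc v) * δ v u)
    ≡⟨ ∑-sift (λ v → g (suc v)) u ⟩
  g (suc u) ∎
  where open ≡-Reasoning

∑-one : ∀ n → ∑[ v < n ] 1 ≡ n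
∑-one zero    = refl
∑-one (suc n) = cong suc (∑-one n)

𝟙 : ∀ {n} → Subset n → Fin n → ℕ
𝟙 T v = if does (v ∈? T) then 1 else 0

𝟙-∈ : ∀ {n} {T : Subset n} {x} → x ∈ T → 𝟙 T x ≡ 1
𝟙-∈ {T = T} {x} x∈T with x ∈? T
... | yes _   = refl
... | no x∉T  = ⊥-elim (x∉T x∈T)

∑-on-mono : ∀ {n} (T : Subset n) (f g : Fin n → ℕ) → (∀ v → v ∈ T → f v ≤ g v) →
            ∑[ v < n ] (𝟙 T v * f v) ≤ ∑[ v < n ] (𝟙 T v * g v)
∑-on-mono T f g f≤g = ∑-mono _ _ on-T
  where
  on-T : ∀ v → 𝟙 T v * f v ≤ 𝟙 T v * g v
  on-T v with v ∈? T
  ... | yes v∈T = +-mono-≤ (f≤g v v∈T) z≤n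
  ... | no _    = z≤n

pigeonhole : ∀ {A : Set} (f : A → ℕ) (xs : List A) → length xs < sum (map f xs) → Σ A λ x → 2 ≤ f x
pigeonhole f []       ()
pigeonhole f (x ∷ xs) more with f x in fx
... | zero          = pigeonhole f xs (≤-trans (n≤1+n _) more)
... | suc zero      = pigeonhole f xs (≤-pred more)
... | suc (suc _)   = x , ≤-trans (s≤s (s≤s z≤n)) (≤-reflexive (sym fx))

x∉p-x : ∀ {n} (p : Subset n) (x : Fin n) → x ∉ p - x
x∉p-x (_ ∷ᵥ _) zero ()
x∉p-x (_ ∷ᵥ p) (suc x) (there x∈p-x) = x∉p-x p x x∈p-x

subsetOf : ∀ {n} {P : Fin n → Set} → (∀ v → Dec (P v)) → Subset n
subsetOf P? = tabulate (λ v → does (P? v))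

∈subsetOf⁺ : ∀ {n} {P : Fin n → Set} (P? : ∀ v → Dec (P v)) {v} → P v → v ∈ subsetOf P?
∈subsetOf⁺ P? {v} pv with P? v in eq
... | yes _ = lookup⇒[]= v _ (trans (lookup∘tabulate _ v) (cong does eq))
... | no ¬pv = ⊥-elim (¬pv pv)

∈subsetOf⁻ : ∀ {n} {P : Fin n → Set} (P? : ∀ v → Dec (P v)) {v} → v ∈ subsetOf P? → P v
∈subsetOf⁻ P? {v} v∈ with P? v | trans (sym (lookup∘tabulate (λ u → does (P? u)) v)) ([]=⇒lookup v∈)
... | yes pv | _  = pv
... | no _   | ()

module Walks {n : ℕ} (E : Fin n → Fin n → Bool) where

  occ-head : ∀ {a b} (w : Walk E a b) → 1 ≤ occ a w
  occ-head [ v ]        = ≤-reflexive (sym (δ-refl v))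
  occ-head (step u _ w) = ≤-trans (≤-reflexive (sym (δ-refl u))) (m≤m+n _ _)

  occ-last : ∀ {a b} (w : Walk E a b) → 1 ≤ occ b w
  occ-last [ v ]        = ≤-reflexive (sym (δ-refl v))
  occ-last (step _ _ w) = ≤-trans (occ-last w) (m≤n+m _ _)

  -- Concatenation of walks; the junction vertex b is counted twice on the right.
  _⊕_ : ∀ {a b c} → Walk E a b → Walk E b c → Walk E a c
  [ _ ]        ⊕ q = q
  step u e p   ⊕ q = step u e (p ⊕ q)

  occ-⊕ : ∀ {a b c} (p : Walk E a b) (q : Walk E b c) x → occ x (p ⊕ q) + δ x b ≡ occ x p + occ x q
  occ-⊕ [ v ]        q x = +-comm (occ x q) (δ x v)
  occ-⊕ (step u _ p) q x = begin
    δ x u + occ x (p ⊕ q) + δ x _  ≡⟨ +-assoc (δ x u) _ _ ⟩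
    δ x u + (occ x (p ⊕ q) + δ x _) ≡⟨ cong (δ x u +_) (occ-⊕ p q x) ⟩
    δ x u + (occ x p + occ x q)     ≡⟨ +-assoc (δ x u) _ _ ⟨
    δ x u + occ x p + occ x q       ∎
    where open ≡-Reasoning

  _≼_ : ∀ {a b c d} → Walk E a b → Walk E c d → Set
  p ≼ w = ∀ y → occ y p ≤ occ y w

  Simple : ∀ {a b} → Walk E a b → Set
  Simple w = ∀ y → occ y w ≤ 1

  prefix : ∀ {a b} (w : Walk E a b) x → 1 ≤ occ x w → Σ (Walk E a x) (_≼ w)
  prefix [ v ] x x∈w with δ-pos x∈w
  ... | refl = [ v ] , λ y → ≤-refl
  prefix (step u e w) x x∈w with x ≟ u
  ... | yes refl = [ x ] , λ y → m≤m+n _ _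
  ... | no _ with prefix w x x∈w
  ... | p , p≼w = step u e p , λ y → +-monoʳ-≤ (δ y u) (p≼w y)

  suffix : ∀ {a b} (w : Walk E a b) x → 1 ≤ occ x w → Σ (Walk E x b) (_≼ w)
  suffix [ v ] x x∈w with δ-pos x∈w
  ... | refl = [ v ] , λ y → ≤-refl
  suffix (step u e w) x x∈w with x ≟ u
  ... | yes refl = step x e w , λ y → ≤-refl
  ... | no _ with suffix w x x∈w
  ... | p , p≼w = p , λ y → ≤-trans (p≼w y) (m≤n+m _ _)

  -- Every walk can be shortcut to a simple walk between the same endpoints:
  -- if the first vertex recurs, jump to its later visit.
  simplify : ∀ {a b} (w : Walk E a b) → Σ (Walk E a b) λ p → p ≼ w × Simple p
  simplify [ v ] = [ v ] , (λ y → ≤-refl) , (λ y → δ-≤1 y v)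
  simplify (step u e w) with simplify w
  ... | p , p≼w , simple with occ u p in u∈p
  ... | suc _ with suffix p u (≤-trans (s≤s z≤n) (≤-reflexive (sym u∈p)))
  ...   | q , q≼p = q , (λ y → ≤-trans (q≼p y) (≤-trans (p≼w y) (m≤n+m _ _))) , (λ y → ≤-trans (q≼p y) (simple y))
  simplify (step u e w) | p , p≼w , simple | zero =
    step u e p , (λ y → +-monoʳ-≤ (δ y u) (p≼w y)) , simple′
    where
    simple′ : ∀ y → δ y u + occ y p ≤ 1
    simple′ y with y ≟ u
    ... | yes refl = ≤-reflexive (cong suc u∈p)
    ... | no _     = simple y

  weight : ∀ {a b} → (Fin n → ℕ) → Walk E a b → ℕ
  weight g [ v ]        = g v
  weight g (step u _ w) = g u + weight g w

  weight-∑ : ∀ {a b} (g : Fin n → ℕ) (w : Walk E a b) → weight g w ≡ ∑[ v < n ] (g v * occ v w)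
  weight-∑ g [ u ]        = sym (∑-sift g u)
  weight-∑ g (step u _ w) = begin
    g u + weight g w                                      ≡⟨ cong₂ _+_ (sym (∑-sift g u)) (weight-∑ g w) ⟩
    ∑[ v < n ] (g v * δ v u) + ∑[ v < n ] (g v * occ v w) ≡⟨ ∑-distrib-+ (λ v → g v * δ v u) (λ v → g v * occ v w) ⟨
    ∑[ v < n ] (g v * δ v u + g v * occ v w)              ≡⟨ sum-cong-≗ (λ v → *-distribˡ-+ (g v) (δ v u) (occ v w)) ⟨
    ∑[ v < n ] (g v * (δ v u + occ v w))                  ∎
    where open ≡-Reasoning

  weight-≥ : ∀ {a b} (g : Fin n → ℕ) (w : Walk E a b) x → 1 ≤ occ x w → g x ≤ weight g w
  weight-≥ g [ v ] x x∈w with δ-pos x∈w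
  ... | refl = ≤-refl
  weight-≥ g (step u _ w) x x∈w with x ≟ u
  ... | yes refl = m≤m+n _ _
  ... | no _     = ≤-trans (weight-≥ g w x x∈w) (m≤n+m _ _)

  simple-short : ∀ {a b} (w : Walk E a b) → Simple w → len w < n
  simple-short w simple = begin-strict
    len w                            <⟨ n<1+n (len w) ⟩
    suc (len w)                      ≡⟨ weight-len w ⟨
    weight (λ _ → 1) w               ≡⟨ weight-∑ (λ _ → 1) w ⟩
    ∑[ v < n ] (1 * occ v w)         ≤⟨ ∑-mono _ _ (λ v → ≤-trans (≤-reflexive (*-identityˡ (occ v w))) (simple v)) ⟩
    ∑[ v < n ] 1                     ≡⟨ ∑-one n ⟩
    n                                ∎
    where
    open ≤-Reasoning
    weight-len : ∀ {a b} (w : Walk E a b) → weight (λ _ → 1) w ≡ suc (len w)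
    weight-len [ _ ]        = refl
    weight-len (step _ _ w) = cong suc (weight-len w)

  visits : ∀ {a b} → Subset n → Walk E a b → ℕ
  visits T = weight (𝟙 T)

  MeetsOnlyAt : ∀ {a b} → Subset n → Fin n → Walk E a b → Set
  MeetsOnlyAt T y w = ∀ x → x ∈ T → occ x w ≡ δ x y

  meetsOnlyAt-visits : ∀ {a b} {T y} (w : Walk E a b) → MeetsOnlyAt T y w → y ∈ T → 1 ≤ occ y w
  meetsOnlyAt-visits {y = y} w only y∈T = ≤-reflexive (sym (trans (only y y∈T) (δ-refl y)))

  firstVisit : ∀ {a b} (T : Subset n) (w : Walk E a b) → 1 ≤ visits T w →
               Σ (Fin n) λ c → c ∈ T × Σ (Walk E a c) (MeetsOnlyAt T c)
  firstVisit T [ v ] 1≤visits with v ∈? T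
  ... | yes v∈T = v , v∈T , [ v ] , λ x _ → refl
  firstVisit T (step u e w) 1≤visits with u ∈? T
  ... | yes u∈T = u , u∈T , [ u ] , λ x _ → refl
  ... | no u∉T with firstVisit T w 1≤visits
  ... | c , c∈T , p , only = c , c∈T , step u e p , λ x x∈T →
          cong₂ _+_ (δ-≢ λ { refl → u∉T x∈T }) (only x x∈T)

  -- A walk visiting T twice contains a walk of positive length between two
  -- vertices of T: from a visit to T up to the next one.
  twoVisits : ∀ {a b} (T : Subset n) (w : Walk E a b) → 2 ≤ visits T w →
              Σ (Fin n) λ a′ → Σ (Fin n) λ b′ → a′ ∈ T × b′ ∈ T × Σ (Walk E a′ b′) λ p → 1 ≤ len p
  twoVisits T [ v ] 2≤visits with v ∈? T
  twoVisits T [ v ] (s≤s ()) | yes _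
  twoVisits T [ v ] ()       | no _
  twoVisits T (step u e w) 2≤visits with u ∈? T
  ... | no _ = twoVisits T w 2≤visits
  ... | yes u∈T with firstVisit T w (≤-pred 2≤visits)
  ... | c , c∈T , p , _ = u , c , u∈T , c∈T , step u e p , s≤s z≤n

  Segment : Subset n → Fin n → Set
  Segment T a = Σ (Fin n) λ c → c ∈ T × Σ (Walk E a c) λ sg → 1 ≤ len sg × (∀ x → x ∈ T → occ x sg ≡ δ x a + δ x c)

  segment : ∀ {a b} (T : Subset n) (w : Walk E a b) → 1 ≤ len w → b ∈ T → Segment T a
  segment {a} T (step _ e w) _ b∈T with firstVisit T w (≤-trans (≤-reflexive (sym (𝟙-∈ b∈T))) (weight-≥ (𝟙 T) w _ (occ-last w)))
  ... | c , c∈T , p , only = c , c∈T , step a e p , s≤s z≤n , λ x x∈T → cong (δ x a +_) (only x x∈T)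

  meetsOnlyAt-≼ : ∀ {a b c d} {T y} (p : Walk E a b) (w : Walk E c d) → p ≼ w → MeetsOnlyAt T y w →
                  1 ≤ occ y p → MeetsOnlyAt T y p
  meetsOnlyAt-≼ {y = y} p w p≼w only y∈p x x∈T = ≤-antisym (≤-trans (p≼w x) (≤-reflexive (only x x∈T))) δ≤occ
    where
    δ≤occ : δ x y ≤ occ x p
    δ≤occ with x ≟ y
    ... | yes refl = y∈p
    ... | no _     = z≤n

  Avoids : ∀ {a b} → Subset n → Walk E a b → Set
  Avoids Y w = ∀ x → x ∈ Y → occ x w ≡ 0

  Hits : ∀ {a b} → Subset n → Walk E a b → Set
  Hits Y w = Σ (Fin n) λ x → x ∈ Y × 1 ≤ occ x w

  hits-or-avoids : ∀ {a b} (Y : Subset n) (w : Walk E a b) → Hits Y w ⊎ Avoids Y w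
  hits-or-avoids Y w with any? (λ x → x ∈? Y ×-dec 1 ≤? occ x w)
  ... | yes (x , x∈Y , x∈w) = inj₁ (x , x∈Y , x∈w)
  ... | no ¬hit = inj₂ λ x x∈Y → n<1⇒n≡0 (≰⇒> λ x∈w → ¬hit (x , x∈Y , x∈w))

  hits⇏avoids : ∀ {a b} {Y : Subset n} (w : Walk E a b) → Hits Y w → Avoids Y w → ⊥
  hits⇏avoids w (x , x∈Y , x∈w) avoids = 1+n≰n (≤-trans x∈w (≤-reflexive (avoids x x∈Y)))

  avoids-≼ : ∀ {a b c d} {Y : Subset n} (p : Walk E a b) (w : Walk E c d) → p ≼ w → Avoids Y w → Avoids Y p
  avoids-≼ p w p≼w avoids x x∈Y = n≤0⇒n≡0 (≤-trans (p≼w x) (≤-reflexive (avoids x x∈Y)))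

  AvoidingWalk : Subset n → Fin n → ℕ → Fin n → Set
  AvoidingWalk Y t k v = Σ (Walk E v t) λ w → Avoids Y w × len w ≤ k

  avoidingWalk? : ∀ Y t k v → Dec (AvoidingWalk Y t k v)
  avoidingWalk? Y t k v with v ∈? Y
  ... | yes v∈Y = no λ (w , avoids , _) → hits⇏avoids w (v , v∈Y , occ-head w) avoids
  ... | no v∉Y with v ≟ t
  ... | yes refl = yes ([ v ] , avoid-here , z≤n)
    where
    avoid-here : Avoids Y [ v ]
    avoid-here x x∈Y = δ-≢ λ { refl → v∉Y x∈Y }
  ... | no v≢t with k
  ...   | zero  = no λ { ([ _ ] , _) → v≢t refl ; (step _ _ _ , _ , ()) }
  ...   | suc k = map′ extend restrict (any? λ u → T? (E v u) ×-dec avoidingWalk? Y t k u)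
    where
    extend : (∃ λ u → IsTrue (E v u) × AvoidingWalk Y t k u) → AvoidingWalk Y t (suc k) v
    extend (u , e , w , avoids , l) = step v e w , (λ x x∈Y → cong₂ _+_ (δ-≢ λ { refl → v∉Y x∈Y }) (avoids x x∈Y)) , s≤s l
    restrict : AvoidingWalk Y t (suc k) v → ∃ λ u → IsTrue (E v u) × AvoidingWalk Y t k u
    restrict ([ _ ] , _) = ⊥-elim (v≢t refl)
    restrict (step _ e w , avoids , s≤s l) = _ , e , w , (λ x x∈Y → m+n≡0⇒n≡0 (δ x v) (avoids x x∈Y)) , l

module StWalks {n : ℕ} (G : StGraph n) where
  open StGraph G

  positive-walk-avoids-s : ∀ {a c} (w : Walk E a c) → 1 ≤ len w → c ≢ s
  positive-walk-avoids-s (step u e [ _ ])         _ refl = subst IsTrue (noIn u) e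
  positive-walk-avoids-s (step _ _ (step v e w)) _      = positive-walk-avoids-s (step v e w) (s≤s z≤n)

  positive-walk-leaves-t : ∀ {c b} (w : Walk E c b) → 1 ≤ len w → c ≢ t
  positive-walk-leaves-t (step _ {v} e _) _ refl = subst IsTrue (noOut v) e

module Separators {n : ℕ} (G : StGraph n) where
  open StGraph G
  open Walks E

  -- An
  -- avoiding st-path shortcuts to a simple one, with fewer than n edges, so
  -- it suffices to search walks of length at most n.
  separates? : (Y : Subset n) → Separator G Y ⊎ Σ (StPath G) (Avoids Y)
  separates? Y with avoidingWalk? Y t n s
  ... | yes (p , avoids , _) = inj₂ (p , avoids)
  ... | no ¬short = inj₁ hit
    where
    hit : (p : StPath G) → Hits Y p
    hit p with hits-or-avoids Y p
    ... | inj₁ hits = hits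
    ... | inj₂ avoids with simplify p
    ... | q , q≼p , simple = ⊥-elim (¬short (q , avoids-≼ q p q≼p avoids , <⇒≤ (simple-short q simple)))

  separator? : (Y : Subset n) → Dec (Separator G Y)
  separator? Y with separates? Y
  ... | inj₁ sep            = yes sep
  ... | inj₂ (p , avoids)   = no λ sep → hits⇏avoids p (sep p) avoids

  PrivatePaths : Subset n → Set
  PrivatePaths X = ∀ x → x ∈ X → Σ (StPath G) (Avoids (X - x))

  -- A separator with private paths is minimal: a sub-separator must meet
  -- the private path of each x ∈ X, and can only do so in x.
  private⇒mvs : ∀ {X} → Separator G X → PrivatePaths X → IsMVS G X
  private⇒mvs {X} sepX privX = sepX , minimal
    where
    minimal : ∀ Y → Y ⊆ X → Separator G Y → X ⊆ Y
    minimal Y Y⊆X sepY {x} x∈X with privX x x∈X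
    ... | p , avoids with sepY p
    ... | v , v∈Y , v∈p with v ≟ x
    ... | yes refl = v∈Y
    ... | no v≢x   = ⊥-elim (hits⇏avoids p (v , x∈p∧x≢y⇒x∈p-y (Y⊆X v∈Y) v≢x , v∈p) avoids)

  -- Conversely, in an mvs X no X - x separates, so each x has a private path.
  mvs⇒private : ∀ {X} → IsMVS G X → PrivatePaths X
  mvs⇒private {X} (_ , minimal) x x∈X with separates? (X - x)
  ... | inj₂ privPath = privPath
  ... | inj₁ sep = ⊥-elim (x∉p-x X x (minimal (X - x) (p─q⊆p X _) sep x∈X))

  -- Hence through every vertex x of an mvs X there is an st-path meeting X
  -- only at x, once: shortcut the private path of x to a simple one.
  mvs⇒through : ∀ {X} → IsMVS G X → ∀ x → x ∈ X → Σ (StPath G) (MeetsOnlyAt X x)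
  mvs⇒through {X} mvsX x x∈X with mvs⇒private mvsX x x∈X
  ... | p , avoids with simplify p
  ... | r , r≼p , simple = r , only
    where
    r-avoids : Avoids (X - x) r
    r-avoids = avoids-≼ r p r≼p avoids
    x∈r : 1 ≤ occ x r
    x∈r with proj₁ mvsX r
    ... | v , v∈X , v∈r with v ≟ x
    ... | yes refl = v∈r
    ... | no v≢x   = ⊥-elim (hits⇏avoids r (v , x∈p∧x≢y⇒x∈p-y v∈X v≢x , v∈r) r-avoids)
    only : MeetsOnlyAt X x r
    only y y∈X with y ≟ x
    ... | yes refl = ≤-antisym (simple y) x∈r
    ... | no y≢x   = r-avoids y (x∈p∧x≢y⇒x∈p-y y∈X y≢x)

  -- Every separator contains an mvs: delete vertices while the rest still
  -- separates (by well-founded recursion on the size of X).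
  shrink : ∀ X → Separator G X → Acc _<_ ∣ X ∣ → Σ (Subset n) λ T → T ⊆ X × IsMVS G T
  shrink X sepX (acc smaller) with any? (λ x → x ∈? X ×-dec separator? (X - x))
  ... | yes (x , x∈X , sep) with shrink (X - x) sep (smaller (x∈p⇒∣p-x∣<∣p∣ x∈X))
  ...   | T , T⊆X-x , mvs = T , (λ x∈T → p─q⊆p X _ (T⊆X-x x∈T)) , mvs
  shrink X sepX (acc smaller) | no ¬removable = X , (λ x∈X → x∈X) , private⇒mvs sepX privX
    where
    privX : PrivatePaths X
    privX x x∈X with separates? (X - x)
    ... | inj₁ sep     = ⊥-elim (¬removable (x , x∈X , sep))
    ... | inj₂ privPath = privPath

  minimalSeparatorIn : ∀ X → Separator G X → Σ (Subset n) λ T → T ⊆ X × IsMVS G T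
  minimalSeparatorIn X sepX = shrink X sepX (<-wellFounded ∣ X ∣)

module Flows {n : ℕ} (G : StGraph n) where
  open StGraph G
  open Walks E

  load-++ : ∀ (ψ χ : Flow G) v → load G (ψ ++ χ) v ≡ load G ψ v + load G χ v
  load-++ ψ χ v = trans (cong sum (map-++ (occ v) ψ χ)) (sum-++ (map (occ v) ψ) (map (occ v) χ))

  dead : ∀ η → (∀ χ → IsFlow G η χ → value G χ ≤ 0) → Dead G η
  dead η bound = ([] , (λ _ _ → z≤n) , refl) , bound

  vanishing⇒dead : ∀ {T} η → Separator G T → (∀ x → x ∈ T → Internal G x) → (∀ x → x ∈ T → η x ≡ 0) → Dead G η
  vanishing⇒dead η sepT internal vanishes = dead η bound
    where
    bound : ∀ χ → IsFlow G η χ → value G χ ≤ 0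
    bound []      _     = z≤n
    bound (p ∷ χ) flowχ with sepT p
    ... | x , x∈T , x∈p = ⊥-elim (1+n≰n (begin
      1                    ≤⟨ x∈p ⟩
      occ x p              ≤⟨ m≤m+n (occ x p) (load G χ x) ⟩
      load G (p ∷ χ) x     ≤⟨ flowχ x (internal x x∈T) ⟩
      η x                  ≡⟨ vanishes x x∈T ⟩
      0                    ∎))
      where open ≤-Reasoning

  -- A flow of maximum value inhibits: a residual flow could be appended to it.
  maximum⇒inhibits : ∀ η ψ → IsFlow G η ψ → (∀ χ → IsFlow G η χ → value G χ ≤ value G ψ) → Inhibits G η ψ
  maximum⇒inhibits η ψ flowψ maximal = flowψ , dead (residual G η ψ) nothing-left
    where
    nothing-left : ∀ χ → IsFlow G (residual G η ψ) χ → value G χ ≤ 0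
    nothing-left χ flowχ = +-cancelˡ-≤ (length ψ) (length χ) 0 (begin
      length ψ + length χ  ≡⟨ length-++ ψ ⟨
      length (ψ ++ χ)      ≤⟨ maximal (ψ ++ χ) flow++ ⟩
      length ψ             ≡⟨ +-identityʳ (length ψ) ⟨
      length ψ + 0         ∎)
      where
      open ≤-Reasoning
      flow++ : IsFlow G η (ψ ++ χ)
      flow++ v internal = begin
        load G (ψ ++ χ) v                          ≡⟨ load-++ ψ χ v ⟩
        load G ψ v + load G χ v                    ≤⟨ +-monoʳ-≤ (load G ψ v) (flowχ v internal) ⟩
        load G ψ v + (η v ∸ load G ψ v)            ≡⟨ m+[n∸m]≡n (flowψ v internal) ⟩
        η v                                        ∎

  weak⇒gap : Weak G → Σ (Charge G) λ η → Σ (Flow G) λ φ → Σ (Flow G) λ ψ →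
             Inhibits G η φ × IsFlow G η ψ × value G φ < value G ψ
  weak⇒gap (η , nothing , nothing , _ , _ , ∞≢∞) = ⊥-elim (∞≢∞ refl)
  weak⇒gap (η , nothing , just _ , noInhibitor , ((ψ , flowψ , refl) , maximal) , _) =
    ⊥-elim (noInhibitor (ψ , maximum⇒inhibits η ψ flowψ maximal))
  weak⇒gap (η , just _ , just _ , ((φ , inhibits , refl) , least) , ((ψ , flowψ , refl) , maximal) , m≢M) =
    η , φ , ψ , inhibits , flowψ ,
    ≤∧≢⇒< (least ψ (maximum⇒inhibits η ψ flowψ maximal)) (λ m≡M → m≢M (cong just m≡M))
  weak⇒gap (η , just _ , nothing , ((φ , inhibits , refl) , _) , unbounded , _)
    with unbounded (suc (value G φ))
  ... | ψ , flowψ , φ<ψ = η , φ , ψ , inhibits , flowψ , φ<ψ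

  weight-load : ∀ (g : Fin n → ℕ) (χ : Flow G) → sum (map (weight g) χ) ≡ ∑[ v < n ] (g v * load G χ v)
  weight-load g []      = sym (∑-zero n g)
  weight-load g (p ∷ χ) = begin
    weight g p + sum (map (weight g) χ)                          ≡⟨ cong₂ _+_ (weight-∑ g p) (weight-load g χ) ⟩
    ∑[ v < n ] (g v * occ v p) + ∑[ v < n ] (g v * load G χ v)   ≡⟨ ∑-distrib-+ (λ v → g v * occ v p) (λ v → g v * load G χ v) ⟨
    ∑[ v < n ] (g v * occ v p + g v * load G χ v)                ≡⟨ sum-cong-≗ (λ v → *-distribˡ-+ (g v) (occ v p) (load G χ v)) ⟨
    ∑[ v < n ] (g v * load G (p ∷ χ) v)                          ∎
    where open ≡-Reasoning

  -- Every path of a flow meets a separator T, so the value of a flow is at most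
  -- its total load on T.
  value≤load-on : ∀ {T} → Separator G T → (χ : Flow G) → value G χ ≤ ∑[ v < n ] (𝟙 T v * load G χ v)
  value≤load-on {T} sepT χ = ≤-trans (counted χ) (≤-reflexive (weight-load (𝟙 T) χ))
    where
    counted : (χ : Flow G) → length χ ≤ sum (map (visits T) χ)
    counted []      = z≤n
    counted (p ∷ χ) with sepT p
    ... | x , x∈T , x∈p = +-mono-≤ (≤-trans (≤-reflexive (sym (𝟙-∈ x∈T))) (weight-≥ (𝟙 T) p x x∈p)) (counted χ)

MVSWithWalk : ∀ {n} → StGraph n → Set
MVSWithWalk {n} G = Σ (Subset n) λ X → IsMVS G X × (Σ (Fin n) λ a → Σ (Fin n) λ b →
  a ∈ X × b ∈ X × Σ (Walk (StGraph.E G) a b) λ w → 1 ≤ len w)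

module Forward {n : ℕ} (G : StGraph n) (η : Charge G) (φ ψ : Flow G)
                (inhibits : Inhibits G η φ) (flowψ : IsFlow G η ψ) (φ<ψ : value G φ < value G ψ) where
  open StGraph G
  open Walks E
  open Separators G
  open Flows G

  Saturated : Fin n → Set
  Saturated v = Internal G v × residual G η φ v ≡ 0

  saturated? : ∀ v → Dec (Saturated v)
  saturated? v = (¬? (v ≟ s) ×-dec ¬? (v ≟ t)) ×-dec (residual G η φ v ≟ℕ 0)

  Z : Subset n
  Z = subsetOf saturated?

  -- A simple st-path avoiding Z would be a flow of value 1 for the residual
  -- charge, which is dead.
  Z-separates : Separator G Z
  Z-separates p with simplify p
  ... | q , q≼p , simple with hits-or-avoids Z q
  ... | inj₁ (x , x∈Z , x∈q) = x , x∈Z , ≤-trans x∈q (q≼p x)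
  ... | inj₂ avoids = ⊥-elim (1+n≰n (proj₂ (proj₂ inhibits) (q ∷ []) residual-flow))
    where
    residual-flow : IsFlow G (residual G η φ) (q ∷ [])
    residual-flow v internal with residual G η φ v in exhausted
    ... | zero  = ≤-reflexive (trans (+-identityʳ _) (avoids v (∈subsetOf⁺ saturated? (internal , exhausted))))
    ... | suc _ = ≤-trans (≤-reflexive (+-identityʳ _)) (≤-trans (simple v) (s≤s z≤n))

  mvsInZ : Σ (Subset n) λ T → T ⊆ Z × IsMVS G T
  mvsInZ = minimalSeparatorIn Z Z-separates

  T : Subset n
  T = proj₁ mvsInZ

  T⊆Z : T ⊆ Z
  T⊆Z = proj₁ (proj₂ mvsInZ)

  T-mvs : IsMVS G T
  T-mvs = proj₂ (proj₂ mvsInZ)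

  -- On T the charge is exhausted by φ, so ψ loads it no more than φ does.
  ψ≤φ-on-T : ∀ v → v ∈ T → load G ψ v ≤ load G φ v
  ψ≤φ-on-T v v∈T with ∈subsetOf⁻ saturated? (T⊆Z v∈T)
  ... | internal , exhausted = ≤-trans (flowψ v internal) (m∸n≡0⇒m≤n exhausted)

  φ-revisits-T : value G φ < sum (map (visits T) φ)
  φ-revisits-T = begin-strict
    value G φ                         <⟨ φ<ψ ⟩
    value G ψ                         ≤⟨ value≤load-on (proj₁ T-mvs) ψ ⟩
    ∑[ v < n ] (𝟙 T v * load G ψ v)   ≤⟨ ∑-on-mono T _ _ ψ≤φ-on-T ⟩
    ∑[ v < n ] (𝟙 T v * load G φ v)   ≡⟨ weight-load (𝟙 T) φ ⟨
    sum (map (visits T) φ)            ∎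
    where open ≤-Reasoning

  mvsWithWalk : MVSWithWalk G
  mvsWithWalk with pigeonhole (visits T) φ φ-revisits-T
  ... | p , twice with twoVisits T p twice
  ... | a , b , a∈T , b∈T , w , positive = T , T-mvs , a , b , a∈T , b∈T , w , positive

-- Cut the walk at its first return c to T.  Through a and through c run
-- st-paths r_a, r_c meeting T only there; splicing r_a up to a, the segment
-- a ⇝ c and r_c from c gives an st-path q meeting T exactly in a and c.  The
-- charge that equals δ_a + δ_c on T and is generous elsewhere admits the flow
-- {r_a, r_c} of value 2 (which is maximum, T being a separator) but is
-- inhibited by {q} alone: min = 1 ≠ 2 = max.
module Backward {n : ℕ} (G : StGraph n) (T : Subset n) (T-mvs : IsMVS G T) (a b : Fin n)
                 (a∈T : a ∈ T) (b∈T : b ∈ T) (w : Walk (StGraph.E G) a b) (positive : 1 ≤ len w) where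
  open StGraph G
  open Walks E
  open StWalks G
  open Separators G
  open Flows G

  T-separates : Separator G T
  T-separates = proj₁ T-mvs

  seg : Segment T a
  seg = segment T w positive b∈T

  c : Fin n
  c = proj₁ seg

  c∈T : c ∈ T
  c∈T = proj₁ (proj₂ seg)

  sg : Walk E a c
  sg = proj₁ (proj₂ (proj₂ seg))

  sg-positive : 1 ≤ len sg
  sg-positive = proj₁ (proj₂ (proj₂ (proj₂ seg)))

  sg-on-T : ∀ x → x ∈ T → occ x sg ≡ δ x a + δ x c
  sg-on-T = proj₂ (proj₂ (proj₂ (proj₂ seg)))

  ra : StPath G
  ra = proj₁ (mvs⇒through T-mvs a a∈T)

  ra-only : MeetsOnlyAt T a ra
  ra-only = proj₂ (mvs⇒through T-mvs a a∈T)

  rc : StPath G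
  rc = proj₁ (mvs⇒through T-mvs c c∈T)

  rc-only : MeetsOnlyAt T c rc
  rc-only = proj₂ (mvs⇒through T-mvs c c∈T)

  pre : Walk E s a
  pre = proj₁ (prefix ra a (meetsOnlyAt-visits ra ra-only a∈T))

  pre-only : MeetsOnlyAt T a pre
  pre-only = meetsOnlyAt-≼ pre ra (proj₂ (prefix ra a (meetsOnlyAt-visits ra ra-only a∈T))) ra-only (occ-last pre)

  suf : Walk E c t
  suf = proj₁ (suffix rc c (meetsOnlyAt-visits rc rc-only c∈T))

  suf-only : MeetsOnlyAt T c suf
  suf-only = meetsOnlyAt-≼ suf rc (proj₂ (suffix rc c (meetsOnlyAt-visits rc rc-only c∈T))) rc-only (occ-head suf)

  q : StPath G
  q = pre ⊕ (sg ⊕ suf)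

  q-on-T : ∀ x → x ∈ T → occ x q ≡ δ x a + δ x c
  q-on-T x x∈T = +-cancelʳ-≡ (δ x a) _ _ (begin
    occ x q + δ x a                ≡⟨ occ-⊕ pre (sg ⊕ suf) x ⟩
    occ x pre + occ x (sg ⊕ suf)   ≡⟨ cong₂ _+_ (pre-only x x∈T) middle ⟩
    δ x a + (δ x a + δ x c)        ≡⟨ +-comm (δ x a) _ ⟩
    δ x a + δ x c + δ x a          ∎)
    where
    open ≡-Reasoning
    middle : occ x (sg ⊕ suf) ≡ δ x a + δ x c
    middle = +-cancelʳ-≡ (δ x c) _ _ (trans (occ-⊕ sg suf x) (cong₂ _+_ (sg-on-T x x∈T) (suf-only x x∈T)))

  -- T consists of internal vertices: s ∈ T would force c = s (as r_c meets T
  -- only at c), but the segment of positive length cannot end at s; dually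
  -- for t and a.
  internal : ∀ x → x ∈ T → Internal G x
  internal x x∈T = x≢s , x≢t
    where
    x≢s : x ≢ s
    x≢s refl = positive-walk-avoids-s sg sg-positive
                 (sym (δ-pos (≤-trans (occ-head rc) (≤-reflexive (rc-only s x∈T)))))
    x≢t : x ≢ t
    x≢t refl = positive-walk-leaves-t sg sg-positive
                 (sym (δ-pos (≤-trans (occ-last ra) (≤-reflexive (ra-only t x∈T)))))

  two : Flow G
  two = ra ∷ rc ∷ []

  η : Charge G
  η v = if does (v ∈? T) then δ v a + δ v c else load G (ra ∷ rc ∷ q ∷ []) v

  η-on-T : ∀ v → v ∈ T → η v ≡ δ v a + δ v c
  η-on-T v v∈T with v ∈? T
  ... | yes _   = refl
  ... | no v∉T  = ⊥-elim (v∉T v∈T)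

  two-flow : IsFlow G η two
  two-flow v _ with v ∈? T
  ... | yes v∈T = ≤-reflexive (cong₂ _+_ (ra-only v v∈T) (trans (+-identityʳ _) (rc-only v v∈T)))
  ... | no _    = +-monoʳ-≤ (occ v ra) (+-monoʳ-≤ (occ v rc) z≤n)

  q-flow : IsFlow G η (q ∷ [])
  q-flow v _ with v ∈? T
  ... | yes v∈T = ≤-reflexive (trans (+-identityʳ _) (q-on-T v v∈T))
  ... | no _    = ≤-trans (m≤n+m _ (occ v rc)) (m≤n+m _ (occ v ra))

  -- q alone exhausts η on the separator T.
  q-inhibits : Inhibits G η (q ∷ [])
  q-inhibits = q-flow , vanishing⇒dead (residual G η (q ∷ [])) T-separates internal exhausted
    where
    exhausted : ∀ x → x ∈ T → η x ∸ (occ x q + 0) ≡ 0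
    exhausted x x∈T = trans (cong₂ _∸_ (η-on-T x x∈T) (trans (+-identityʳ _) (q-on-T x x∈T))) (n∸n≡0 (δ x a + δ x c))

  min≡1 : IsMin G η (just 1)
  min≡1 = ((q ∷ []) , q-inhibits , refl) , least
    where
    least : ∀ φ → Inhibits G η φ → 1 ≤ value G φ
    least []      (_ , (_ , bound)) with bound two two-flow
    ... | ()
    least (_ ∷ _) _ = s≤s z≤n

  -- Every path of a flow meets T, where η has total mass 2.
  max≡2 : IsMax G η (just 2)
  max≡2 = (two , two-flow , refl) , bound
    where
    bound : ∀ ψ → IsFlow G η ψ → value G ψ ≤ 2
    bound ψ flowψ = begin
      value G ψ                                            ≤⟨ value≤load-on T-separates ψ ⟩
      ∑[ v < n ] (𝟙 T v * load G ψ v)                      ≤⟨ ∑-on-mono T _ _ ψ≤η ⟩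
      ∑[ v < n ] (𝟙 T v * (δ v a + δ v c))                 ≡⟨ sum-cong-≗ (λ v → *-distribˡ-+ (𝟙 T v) (δ v a) (δ v c)) ⟩
      ∑[ v < n ] (𝟙 T v * δ v a + 𝟙 T v * δ v c)           ≡⟨ ∑-distrib-+ (λ v → 𝟙 T v * δ v a) (λ v → 𝟙 T v * δ v c) ⟩
      ∑[ v < n ] (𝟙 T v * δ v a) + ∑[ v < n ] (𝟙 T v * δ v c) ≡⟨ cong₂ _+_ (∑-sift (𝟙 T) a) (∑-sift (𝟙 T) c) ⟩
      𝟙 T a + 𝟙 T c                                        ≡⟨ cong₂ _+_ (𝟙-∈ a∈T) (𝟙-∈ c∈T) ⟩
      2                                                    ∎
      where
      open ≤-Reasoning
      ψ≤η : ∀ v → v ∈ T → load G ψ v ≤ δ v a + δ v c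
      ψ≤η v v∈T = ≤-trans (flowψ v (internal v v∈T)) (≤-reflexive (η-on-T v v∈T))

  weak : Weak G
  weak = η , just 1 , just 2 , min≡1 , max≡2 , λ ()

theorem1 : ∀ (n : ℕ) (G : StGraph n) →
    Weak G ⇔ (Σ (Subset n) λ X → IsMVS G X × (Σ (Fin n) λ a → Σ (Fin n) λ b →
    a ∈ X × b ∈ X × Σ (Walk (StGraph.E G) a b) λ w → 1 ≤ len w))
theorem1 n G = mk⇔ forward backward
  where
  forward : Weak G → MVSWithWalk G
  forward weakG with Flows.weak⇒gap G weakG
  ... | η , φ , ψ , inhibits , flowψ , φ<ψ = Forward.mvsWithWalk G η φ ψ inhibits flowψ φ<ψ
  backward : MVSWithWalk G → Weak G
  backward (T , T-mvs , a , b , a∈T , b∈T , w , positive) = Backward.weak G T T-mvs a b a∈T b∈T w positive
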